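{- Let $G$ be a connected graph, let $p$ be an odd prime, let $c\colon V(G)\to\mathbb Z_p$ be a vertex colouring and let $c'$ be the corresponding canonical edge colouring. If $G$ is not bipartite, then every automorphism of $G$ which preserves $c'$ also preserves $c$.
   Context: Graphs are simple and undirected, possibly infinite. The canonical edge colouring of $c$ is $c'(uv)=c(u)+c(v)$ (addition in $\mathbb Z_p$). An automorphism $\gamma$ preserves a vertex colouring $c$ if $c(\gamma x)=c(x)$ for all vertices $x$, and preserves an edge colouring $c'$ if $c'(\gamma e)=c'(e)$ for all edges $e$. -}

module Defs where

open import Level using (Level; _⊔_; suc)
open import Data.Nat using (ℕ; NonZero; _%_)
import Data.Nat as ℕ
open import Data.Nat.DivMod using (m%n<n)
open import Data.Fin using (Fin; toℕ; fromℕ<)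
open import Data.Bool using (Bool)
open import Relation.Nullary using (¬_)
open import Relation.Binary.PropositionalEquality using (_≡_)
open import Function.Definitions using (Bijective)
open import Function.Bundles using (_⇔_)
open import Data.Product using (Σ; _×_)

record Graph (a b : Level) : Set (Level.suc (a ⊔ b)) where
  field
    V     : Set a
    _~_   : V → V → Set b
    sym   : ∀ {u v} → u ~ v → v ~ u
    irrefl : ∀ {u} → ¬ (u ~ u)

module _ {a b} (G : Graph a b) where
  open Graph G

  data Walk : V → V → Set (a ⊔ b) where
    here : ∀ {u} → Walk u u
    step : ∀ {u v w} → u ~ v → Walk v w → Walk u w

  Connected : Set (a ⊔ b)
  Connected = ∀ u v → Walk u v

  Bipartite : Set (a ⊔ b)
  Bipartite = Σ (V → Bool) λ f → ∀ {u v} → u ~ v → ¬ (f u ≡ f v)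

  IsAutomorphism : (V → V) → Set (a ⊔ b)
  IsAutomorphism γ = Bijective _≡_ _≡_ γ × (∀ u v → (u ~ v) ⇔ (γ u ~ γ v))

ℤ_ : ℕ → Set
ℤ p = Fin p

addℤ : (p : ℕ) → ⦃ _ : NonZero p ⦄ → Fin p → Fin p → Fin p
addℤ p x y = fromℕ< (m%n<n (toℕ x ℕ.+ toℕ y) p)

module _ {a b} (G : Graph a b) (p : ℕ) ⦃ _ : NonZero p ⦄ where
  open Graph G

  -- canonical edge colouring c'(uv) = c(u) + c(v), given on ordered adjacent pairs
  canonical : (V → Fin p) → V → V → Fin p
  canonical c u v = addℤ p (c u) (c v)

  PreservesVertexColouring : (V → V) → (V → Fin p) → Set a
  PreservesVertexColouring γ c = ∀ x → c (γ x) ≡ c x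

  PreservesEdgeColouring : (V → V) → (V → V → Fin p) → Set (a ⊔ b)
  PreservesEdgeColouring γ c' = ∀ u v → u ~ v → c' (γ u) (γ v) ≡ c' u v

-- Put d(v) = c(γ v) − c(v) in ℤ_p. Preservation of c' says d(u) + d(v) = 0 on every edge uv, so
-- along a walk from x the value of d alternates between d(x) and −d(x). If d(x) ≠ 0 then
-- d(x) ≠ −d(x) because p is odd, and "d(v) = d(x)" is a proper 2-colouring of the connected
-- graph G, which therefore is bipartite.
module Submission where

open import Defs
open import Data.Nat using (ℕ; NonZero)
open import Data.Nat.Primality using (Prime)
open import Data.Nat.Divisibility using (_∣_)
open import Data.Fin using (Fin)
open import Relation.Nullary using (¬_)

open import Data.Fin as Fin using (toℕ)
open import Data.Fin.Properties using (toℕ-fromℕ<; toℕ-injective; toℕ<n)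
open import Data.Integer using (ℤ; +_; _+_; _-_; _*_; ∣_∣; _%ℕ_; _/ℕ_)
open import Data.Integer.Coprimality using (coprime-divisor)
open import Data.Integer.DivMod using (a≡a%ℕn+[a/ℕn]*n)
open import Data.Integer.Divisibility.Signed
  using (divides; _∣?_; ∣⇒∣ᵤ; ∣ᵤ⇒∣; ∣m∣n⇒∣m-n) renaming (_∣_ to _∣ℤ_)
open import Data.Integer.Properties
  using (+-injective; pos-+; [+m]-[+n]≡m⊖n; ∣m⊝n∣≤m⊔n; ∣i∣≡0⇒i≡0; i-j≡0⇒i≡j; +-inverseʳ)
open import Data.Integer.Tactic.RingSolver using (solve-∀)
import Data.Nat as ℕ
open import Data.Nat.Coprimality using (prime⇒coprime)
open import Data.Nat.Divisibility using (>⇒∤; ∣-refl)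
open import Data.Nat.Primality using (prime⇒nonTrivial)
open import Data.Nat.Properties using (≤∧≢⇒<; ≤-<-trans; ⊔-pres-<m)
open import Data.Product using (_,_)
open import Data.Sum using (_⊎_; inj₁; [_,_]; map; swap)
open import Function using (_∘_; id)
open import Relation.Nullary using (yes; no; does)
open import Relation.Nullary.Decidable using (decidable-stable)
open import Relation.Unary using (Pred; Decidable)
open import Relation.Binary.PropositionalEquality
  using (_≡_; refl; sym; trans; cong; cong₂; subst; module ≡-Reasoning)

module _ {a b} (G : Graph a b) where
  open Graph G using (V; _~_)

  module _ {ℓ} {P Q : Pred V ℓ}
           (P⇒Q : ∀ {u v} → u ~ v → P u → Q v)
           (Q⇒P : ∀ {u v} → u ~ v → Q u → P v) where

    walk-alternates : ∀ {u w} → Walk G u w → P u ⊎ Q u → P w ⊎ Q w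
    walk-alternates here       = id
    walk-alternates (step e w) = walk-alternates w ∘ swap ∘ map (P⇒Q e) (Q⇒P e)

    alternating⇒bipartite : Connected G → Decidable P → (∀ {v} → P v → ¬ Q v) →
                            ∀ {x} → P x → Bipartite G
    alternating⇒bipartite connected P? disjoint {x} Px = (λ v → does (P? v)) , proper
      where
      proper : ∀ {u v} → u ~ v → ¬ (does (P? u) ≡ does (P? v))
      proper {u} {v} e with P? u | P? v
      ... | yes Pu  | yes Pv  = λ _ → disjoint Pv (P⇒Q e Pu)
      ... | no  ¬Pu | no  ¬Pv = λ _ → [ ¬Pu , ¬Pv ∘ Q⇒P e ] (walk-alternates (connected x u) (inj₁ Px))
      ... | yes _   | no  _   = λ ()
      ... | no  _   | yes _   = λ ()

  ∣-alternating⇒bipartite : Connected G → (m : ℤ) (d : V → ℤ) →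
                            (∀ {u v} → u ~ v → m ∣ℤ d u + d v) →
                            ∀ x → ¬ (m ∣ℤ + 2 * d x) → Bipartite G
  ∣-alternating⇒bipartite connected m d alternates x m∤2dx =
    alternating⇒bipartite P⇒Q Q⇒P connected (λ v → m ∣? d v - d x) disjoint Px
    where
    P Q : Pred V _
    P v = m ∣ℤ d v - d x
    Q v = m ∣ℤ d v + d x

    P⇒Q : ∀ {u v} → u ~ v → P u → Q v
    P⇒Q {u} {v} e Pu = subst (m ∣ℤ_) (lemma (d u) (d v) (d x)) (∣m∣n⇒∣m-n (alternates e) Pu)
      where lemma : ∀ s t y → (s + t) - (s - y) ≡ t + y
            lemma = solve-∀

    Q⇒P : ∀ {u v} → u ~ v → Q u → P v
    Q⇒P {u} {v} e Qu = subst (m ∣ℤ_) (lemma (d u) (d v) (d x)) (∣m∣n⇒∣m-n (alternates e) Qu)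
      where lemma : ∀ s t y → (s + t) - (s + y) ≡ t - y
            lemma = solve-∀

    disjoint : ∀ {v} → P v → ¬ Q v
    disjoint {v} Pv Qv = m∤2dx (subst (m ∣ℤ_) (lemma (d v) (d x)) (∣m∣n⇒∣m-n Qv Pv))
      where lemma : ∀ t y → (t + y) - (t - y) ≡ + 2 * y
            lemma = solve-∀

    Px : P x
    Px = subst (m ∣ℤ_) (sym (+-inverseʳ (d x))) (divides (+ 0) refl)

%ℕ≡⇒∣- : ∀ i j d .{{_ : NonZero d}} → i %ℕ d ≡ j %ℕ d → + d ∣ℤ i - j
%ℕ≡⇒∣- i j d i%d≡j%d = divides (i /ℕ d - j /ℕ d) (begin
  i - j                                                     ≡⟨ cong₂ _-_ (a≡a%ℕn+[a/ℕn]*n i d) (a≡a%ℕn+[a/ℕn]*n j d) ⟩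
  (+ (i %ℕ d) + i /ℕ d * + d) - (+ (j %ℕ d) + j /ℕ d * + d) ≡⟨ cancel-remainders (i /ℕ d) (j /ℕ d) (+ d) (cong +_ i%d≡j%d) ⟩
  (i /ℕ d - j /ℕ d) * + d                                   ∎)
  where
  open ≡-Reasoning
  cancel-remainders : ∀ {r r′} s t n → r ≡ r′ → (r + s * n) - (r′ + t * n) ≡ (s - t) * n
  cancel-remainders {r} s t n refl = lemma r s t n
    where lemma : ∀ r s t n → (r + s * n) - (r + t * n) ≡ (s - t) * n
          lemma = solve-∀

∣m-n∧<⇒≡ : ∀ {d m n} → m ℕ.< d → n ℕ.< d → + d ∣ℤ + m - + n → m ≡ n
∣m-n∧<⇒≡ {d} {m} {n} m<d n<d d∣m-n =
  +-injective (i-j≡0⇒i≡j (+ m) (+ n) (∣i∣≡0⇒i≡0 (∣∧<⇒≡0 (∣⇒∣ᵤ d∣m-n) ∣m-n∣<d)))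
  where
  ∣m-n∣<d : ∣ + m - + n ∣ ℕ.< d
  ∣m-n∣<d = subst (ℕ._< d) (cong ∣_∣ (sym ([+m]-[+n]≡m⊖n m n)))
                  (≤-<-trans (∣m⊝n∣≤m⊔n m n) (⊔-pres-<m m<d n<d))

  ∣∧<⇒≡0 : ∀ {k} → d ∣ k → k ℕ.< d → k ≡ 0
  ∣∧<⇒≡0 {ℕ.zero}  _   _   = refl
  ∣∧<⇒≡0 {ℕ.suc _} d∣k k<d with () ← >⇒∤ k<d d∣k

odd-prime-∣2*⇒∣ : ∀ {p} → Prime p → ¬ (2 ∣ p) → ∀ {i} → + p ∣ℤ + 2 * i → + p ∣ℤ i
odd-prime-∣2*⇒∣ {p} p-prime 2∤p {i} p∣2i =
  ∣ᵤ⇒∣ (coprime-divisor (+ p) (+ 2) i (prime⇒coprime p-prime 2<p) (∣⇒∣ᵤ p∣2i))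
  where
  2<p : 2 ℕ.< p
  2<p = ≤∧≢⇒< (ℕ.nonTrivial⇒n>1 p {{prime⇒nonTrivial p-prime}})
              (λ 2≡p → 2∤p (subst (2 ∣_) 2≡p ∣-refl))

addℤ-≡⇒∣ : ∀ {p} ⦃ _ : NonZero p ⦄ {x y x′ y′ : Fin p} → addℤ p x y ≡ addℤ p x′ y′ →
           + p ∣ℤ (+ toℕ x - + toℕ x′) + (+ toℕ y - + toℕ y′)
addℤ-≡⇒∣ {p} {x} {y} {x′} {y′} eq = subst (+ p ∣ℤ_) regroup
  (%ℕ≡⇒∣- (+ (toℕ x ℕ.+ toℕ y)) (+ (toℕ x′ ℕ.+ toℕ y′)) p
    (trans (sym (toℕ-fromℕ< _)) (trans (cong toℕ eq) (toℕ-fromℕ< _))))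
  where
  open ≡-Reasoning
  lemma : ∀ s t s′ t′ → (s + t) - (s′ + t′) ≡ (s - s′) + (t - t′)
  lemma = solve-∀
  regroup : + (toℕ x ℕ.+ toℕ y) - + (toℕ x′ ℕ.+ toℕ y′) ≡ (+ toℕ x - + toℕ x′) + (+ toℕ y - + toℕ y′)
  regroup = begin
    + (toℕ x ℕ.+ toℕ y) - + (toℕ x′ ℕ.+ toℕ y′)       ≡⟨ cong₂ _-_ (pos-+ (toℕ x) (toℕ y)) (pos-+ (toℕ x′) (toℕ y′)) ⟩
    (+ toℕ x + + toℕ y) - (+ toℕ x′ + + toℕ y′)       ≡⟨ lemma (+ toℕ x) (+ toℕ y) (+ toℕ x′) (+ toℕ y′) ⟩
    (+ toℕ x - + toℕ x′) + (+ toℕ y - + toℕ y′)       ∎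

proposition10 : ∀ {a b} (G : Graph a b) (p : ℕ) ⦃ _ : NonZero p ⦄ →
    Prime p → ¬ (2 ∣ p) → Connected G →
    (c : Graph.V G → Fin p) → ¬ Bipartite G →
    (γ : Graph.V G → Graph.V G) → IsAutomorphism G γ →
    PreservesEdgeColouring G p γ (canonical G p c) →
    PreservesVertexColouring G p γ c
proposition10 G p p-prime 2∤p connected c ¬bipartite γ _ preserves x =
  decidable-stable (c (γ x) Fin.≟ c x) λ γx≢x →
    ¬bipartite (∣-alternating⇒bipartite G connected (+ p) d alternates x (γx≢x ∘ fixed))
  where
  open Graph G using (V; _~_)

  d : V → ℤ
  d v = + toℕ (c (γ v)) - + toℕ (c v)

  alternates : ∀ {u v} → u ~ v → + p ∣ℤ d u + d v
  alternates {u} {v} e = addℤ-≡⇒∣ {x = c (γ u)} {c (γ v)} {c u} {c v} (preserves u v e)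

  fixed : + p ∣ℤ + 2 * d x → c (γ x) ≡ c x
  fixed = toℕ-injective ∘ ∣m-n∧<⇒≡ (toℕ<n _) (toℕ<n _) ∘ odd-prime-∣2*⇒∣ p-prime 2∤p
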